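{- Let $(N,\mathcal{W})$ be a complete simple game without vetoers with $n$ players, equivalence classes $N_1,\dots,N_t$ ordered by decreasing desirability, $n_j=|N_j|$, and a unique shift-minimal winning vector $(m_1,\dots,m_t)$. Then $$\nu(N,\mathcal{W})=\max_{1\le i\le t}\left\lceil\frac{\sum_{j=1}^i n_j}{\sum_{j=1}^i (n_j-m_j)}\right\rceil\le\max_{1\le i\le t}\left\lceil\frac{\sum_{j=1}^i n_j}{i}\right\rceil\le \max(2,\,n-2t+3).$$
   Context: A simple game $(N,\mathcal{W})$: $N$ finite, $\mathcal{W}$ a family of subsets (winning coalitions) with $\emptyset\notin\mathcal{W}$, $N\in\mathcal{W}$, closed under supersets; a vetoer is a player in every winning coalition; $\nu(N,\mathcal{W})$ is the minimum number of winning coalitions with empty intersection. Write $i\sqsupseteq j$ if for every $S$ with $j\in S\subseteq N\setminus\{i\}$, $S\in\mathcal{W}$ implies $(S\setminus\{j\})\cup\{i\}\in\mathcal{W}$. The game is complete if $\sqsupseteq$ is a total preorder; its equivalence classes $N_1,\dots,N_t$ are ordered so that players in $N_a$ are strictly more desirable than those in $N_b$ for $a<b$. The coalition vector of $S$ is $(|S\cap N_1|,\dots,|S\cap N_t|)$. For $u,v\in\mathbb{N}_{\ge0}^t$ write $u\preceq v$ if $\sum_{j\le i}u_j\le\sum_{j\le i}v_j$ for all $i$. A winning coalition vector $u$ is shift-minimal winning if every coalition vector $v\preceq u$, $v\ne u$, is losing. Having the unique shift-minimal winning vector $m$ means $S$ is winning iff $m\preceq$ (coalition vector of $S$). -}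

module Defs where

open import Data.Bool using (Bool; true; false)
open import Data.Nat using (ℕ; zero; suc; _+_; _∸_; _≤_; _/_; _⊔_)
open import Data.Fin using (Fin; toℕ) renaming (zero to fzero; suc to fsuc; _≤_ to _≤ᶠ_)
open import Data.Fin.Subset using (Subset; _∈_; _∉_; _⊆_; ⊥; ⊤; _∩_; _∪_; ⋂; ∣_∣; ⁅_⁆; _-_)
open import Data.Vec using (tabulate)
open import Data.List using (List; length)
open import Data.List.Relation.Unary.All using (All)
open import Data.Product using (Σ; ∃; _×_)
open import Data.Sum using (_⊎_)
open import Relation.Nullary using (¬_)
open import Relation.Nullary.Decidable using (⌊_⌋)
open import Relation.Binary.PropositionalEquality using (_≡_)
open import Relation.Binary.Structures using (IsTotalPreorder)
open import Function using (_⇔_)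
open import Function.Definitions using (Surjective)
import Data.Fin as F

Win : ∀ {n} → (Subset n → Bool) → Subset n → Set
Win W S = W S ≡ true

record SimpleGame {n : ℕ} (W : Subset n → Bool) : Set where
  field
    empty-losing : W ⊥ ≡ false
    grand-winning : W ⊤ ≡ true
    monotone : ∀ S T → S ⊆ T → Win W S → Win W T

Vetoer : ∀ {n} → (Subset n → Bool) → Fin n → Set
Vetoer W i = ∀ S → Win W S → i ∈ S

NoVetoer : ∀ {n} → (Subset n → Bool) → Set
NoVetoer W = ∀ i → ¬ Vetoer W i

IsNu : ∀ {n} → (Subset n → Bool) → ℕ → Set
IsNu {n} W k =
  (Σ (List (Subset n)) λ L → length L ≡ k × All (Win W) L × ⋂ L ≡ ⊥)
  × (∀ (L : List (Subset n)) → All (Win W) L → ⋂ L ≡ ⊥ → k ≤ length L)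

Desirable : ∀ {n} → (Subset n → Bool) → Fin n → Fin n → Set
Desirable W i j = ∀ S → j ∈ S → i ∉ S → Win W S → Win W ((S - j) ∪ ⁅ i ⁆)

Complete : ∀ {n} → (Subset n → Bool) → Set
Complete W = IsTotalPreorder _≡_ (Desirable W)

-- c : Fin n → Fin t assigns each player its equivalence class N_{c i + 1};
-- classes are nonempty and ordered by decreasing desirability:
-- i ⊒ j iff class index of i ≤ class index of j.
OrderedClasses : ∀ {n t} → (Subset n → Bool) → (Fin n → Fin t) → Set
OrderedClasses W c = Surjective _≡_ _≡_ c × (∀ i j → Desirable W i j ⇔ (c i ≤ᶠ c j))

classSet : ∀ {n t} → (Fin n → Fin t) → Fin t → Subset n
classSet c a = tabulate (λ i → ⌊ c i F.≟ a ⌋)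

classSize : ∀ {n t} → (Fin n → Fin t) → Fin t → ℕ
classSize c a = ∣ classSet c a ∣

coalVec : ∀ {n t} → (Fin n → Fin t) → Subset n → Fin t → ℕ
coalVec c S a = ∣ S ∩ classSet c a ∣

sumFirst : ∀ {t} → (Fin t → ℕ) → ℕ → ℕ
sumFirst {zero} f k = 0
sumFirst {suc t} f zero = 0
sumFirst {suc t} f (suc k) = f fzero + sumFirst (λ j → f (fsuc j)) k

prefix : ∀ {t} → (Fin t → ℕ) → Fin t → ℕ
prefix f i = sumFirst f (suc (toℕ i))

_⪯_ : ∀ {t} → (Fin t → ℕ) → (Fin t → ℕ) → Set
u ⪯ v = ∀ i → prefix u i ≤ prefix v i

ShiftMinimalWinning : ∀ {n t} → (Subset n → Bool) → (Fin n → Fin t) → (Fin t → ℕ) → Set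
ShiftMinimalWinning W c m =
  (Σ _ λ S → (∀ a → coalVec c S a ≡ m a) × Win W S)
  × (∀ T → coalVec c T ⪯ m → ¬ (∀ a → coalVec c T a ≡ m a) → W T ≡ false)

UniqueSMW : ∀ {n t} → (Subset n → Bool) → (Fin n → Fin t) → (Fin t → ℕ) → Set
UniqueSMW W c m = ShiftMinimalWinning W c m × (∀ S → Win W S ⇔ (m ⪯ coalVec c S))

-- ceiling division; the value for divisor 0 is an unused convention
ceilDiv : ℕ → ℕ → ℕ
ceilDiv a zero = 0
ceilDiv a (suc b) = (a + b) / suc b

maxFin : ∀ t → (Fin t → ℕ) → ℕ
maxFin zero f = 0
maxFin (suc t) f = f fzero ⊔ maxFin t (λ j → f (fsuc j))

module Submission where

-- Write size i = n₁ + … + nᵢ₊₁ and slack i = Σ_{j ≤ i} (nⱼ − mⱼ). Since m is the unique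
-- shift-minimal winning vector, a coalition is winning iff for every i it misses at most
-- slack i of the size i players in the first i + 1 classes. So if k winning coalitions have
-- empty intersection, their complements cover each such block and size i ≤ k · slack i,
-- whence ν ≥ max ⌈size i / slack i⌉. Conversely, list the players class by class and let
-- coalition r omit the players whose position is ≡ r (mod K): each block loses at most
-- ⌈size i / K⌉ ≤ slack i players, so these K coalitions win and have empty intersection.
-- Without vetoers mⱼ < nⱼ, and mⱼ ≥ 1 for every class but the last, since otherwise
-- exchanging a player of class j for one of class j + 1 would preserve winning and the two
-- classes would not be strictly ordered. Hence slack i ≥ i + 1 and nⱼ ≥ 2 for j < t, which
-- give the remaining two inequalities.

open import Defs
open import Level using (Level; 0ℓ)
open import Data.Bool using (Bool)
open import Data.Fin using (Fin; zero; suc; toℕ; fromℕ<; _≟_; _≤?_) renaming (_≤_ to _≤ᶠ_; _<_ to _<ᶠ_)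
open import Data.Fin.Properties using (suc-injective; toℕ-injective; toℕ-fromℕ<; toℕ<n)
import Data.Fin.Properties as Finₚ
open import Data.Fin.Subset using (Subset; inside; outside; _∈_; _∉_; ⊤; ⊥; _∩_; _∪_; _─_; _-_; ⁅_⁆; ⋂; ∣_∣)
open import Data.Fin.Subset.Properties
  using (_∈?_; drop-there; ∈⊤; ∉⊥; ⊥⊆; ⊆-antisym; ∩-identityˡ; x∈p∩q⁺; x∈p∩q⁻; x∈p∪q⁺; x∈p∪q⁻;
         x∈⁅x⁆; x∈⁅y⁆⇒x≡y; p─q⊆p; x∈p∧x≢y⇒x∈p-y)
open import Data.List as List using (List; []; _∷_; length)
open import Data.List.Properties using (length-tabulate)
open import Data.List.Relation.Unary.All as All using (All; []; _∷_)
import Data.List.Relation.Unary.All.Properties as All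
open import Data.List.Relation.Unary.Any as Any using (Any)
import Data.List.Relation.Unary.Any.Properties as Any
open import Data.Nat using (ℕ; zero; suc; _+_; _∸_; _*_; _≤_; _<_; _⊔_; z≤n; s≤s; s≤s⁻¹; NonZero; >-nonZero)
open import Data.Nat.Properties hiding (_≟_; _≤?_; suc-injective)
open import Algebra.Properties.CommutativeSemigroup +-commutativeSemigroup using (interchange)
open import Data.Nat.DivMod using (_/_; _%_; _mod_; _divMod_; DivMod; m≡m%n+[m/n]*n; m%n<n; m<n*o⇒m/o<n)
open import Data.Nat.Tactic.RingSolver using (solve-∀)
open import Data.Empty using (⊥-elim)
open import Data.Product using (Σ; _×_; _,_; proj₁; proj₂)
open import Data.Product.Relation.Binary.Lex.Strict using (×-Lex; ×-isStrictTotalOrder)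
open import Data.Product.Relation.Binary.Pointwise.NonDependent using (Pointwise)
open import Data.Sum using (inj₁; inj₂)
open import Data.Vec using ([]; _∷_; here; there; tabulate)
open import Data.Vec.Properties using (lookup∘tabulate; lookup⇒[]=; []=⇒lookup)
open import Function using (_∘_; _on_; case_of_)
open import Function.Bundles using (Equivalence)
open import Relation.Binary using (Rel; IsStrictTotalOrder; tri<; tri≈; tri>)
import Relation.Binary.Construct.On as On
open import Relation.Binary.PropositionalEquality
open import Relation.Nullary using (Dec; yes; no; ¬_; contradiction; _×-dec_)
open import Relation.Nullary.Decidable using (⌊_⌋; decidable-stable)
open import Relation.Unary using (Pred; Decidable; _⊆_)
open import Relation.Unary.Properties using (_∩?_; ∁?; U?; ∅?)

private variable
  ℓ ℓ′ : Level
  n t : ℕ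

-- Counting the elements of Fin n satisfying a decidable predicate

indicator : ∀ {A : Set ℓ} → Dec A → ℕ
indicator (yes _) = 1
indicator (no _)  = 0

indicator-mono : ∀ {A : Set ℓ} {B : Set ℓ′} → (A → B) → (a : Dec A) (b : Dec B) → indicator a ≤ indicator b
indicator-mono A⇒B (yes _) (yes _) = ≤-refl
indicator-mono A⇒B (yes a) (no ¬b) = contradiction (A⇒B a) ¬b
indicator-mono A⇒B (no _)  _       = z≤n

indicator-cong : ∀ {A : Set ℓ} {B : Set ℓ′} → (A → B) → (B → A) → (a : Dec A) (b : Dec B) →
                 indicator a ≡ indicator b
indicator-cong A⇒B B⇒A a b = ≤-antisym (indicator-mono A⇒B a b) (indicator-mono B⇒A b a)

indicator-yes : ∀ {A : Set ℓ} → A → (a : Dec A) → indicator a ≡ 1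
indicator-yes a (yes _) = refl
indicator-yes a (no ¬a) = contradiction a ¬a

indicator-no : ∀ {A : Set ℓ} → ¬ A → (a : Dec A) → indicator a ≡ 0
indicator-no ¬a (yes a) = contradiction a ¬a
indicator-no ¬a (no _)  = refl

count : {P : Pred (Fin n) ℓ} → Decidable P → ℕ
count {zero}  P? = 0
count {suc n} P? = indicator (P? zero) + count (P? ∘ suc)

count-mono : {P : Pred (Fin n) ℓ} {Q : Pred (Fin n) ℓ′} (P? : Decidable P) (Q? : Decidable Q) →
             P ⊆ Q → count P? ≤ count Q?
count-mono {zero}  _  _  _   = z≤n
count-mono {suc n} P? Q? P⊆Q =
  +-mono-≤ (indicator-mono P⊆Q (P? zero) (Q? zero)) (count-mono (P? ∘ suc) (Q? ∘ suc) P⊆Q)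

count-cong : {P : Pred (Fin n) ℓ} {Q : Pred (Fin n) ℓ′} (P? : Decidable P) (Q? : Decidable Q) →
             P ⊆ Q → Q ⊆ P → count P? ≡ count Q?
count-cong P? Q? P⊆Q Q⊆P = ≤-antisym (count-mono P? Q? P⊆Q) (count-mono Q? P? Q⊆P)

count-⊂ : {P : Pred (Fin n) ℓ} {Q : Pred (Fin n) ℓ′} (P? : Decidable P) (Q? : Decidable Q) →
          P ⊆ Q → ∀ {x} → Q x → ¬ P x → count P? < count Q?
count-⊂ {suc n} P? Q? P⊆Q {zero} qx ¬px with P? zero | Q? zero
... | yes px | _     = contradiction px ¬px
... | no _   | yes _ = s≤s (count-mono (P? ∘ suc) (Q? ∘ suc) P⊆Q)
... | no _   | no ¬q = contradiction qx ¬q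
count-⊂ {suc n} P? Q? P⊆Q {suc x} qx ¬px =
  +-mono-≤-< (indicator-mono P⊆Q (P? zero) (Q? zero)) (count-⊂ (P? ∘ suc) (Q? ∘ suc) P⊆Q qx ¬px)

count-empty : {P : Pred (Fin n) ℓ} (P? : Decidable P) → (∀ x → ¬ P x) → count P? ≡ 0
count-empty {zero}  P? ∅ = refl
count-empty {suc n} P? ∅ with P? zero
... | yes p = contradiction p (∅ zero)
... | no _  = count-empty (P? ∘ suc) (∅ ∘ suc)

count-pos : {P : Pred (Fin n) ℓ} (P? : Decidable P) → ∀ {x} → P x → 0 < count P?
count-pos {n = n} P? px = subst (_< count P?) (count-empty (∅? {A = Fin n}) λ _ ()) (count-⊂ ∅? P? (λ ()) px λ ())

count-U : count (U? {A = Fin n}) ≡ n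
count-U {zero}  = refl
count-U {suc n} = cong suc count-U

count-split : {P : Pred (Fin n) ℓ} {Q : Pred (Fin n) ℓ′} (P? : Decidable P) (Q? : Decidable Q) →
              count P? ≡ count (P? ∩? Q?) + count (P? ∩? ∁? Q?)
count-split {zero}  P? Q? = refl
count-split {suc n} P? Q? with P? zero | Q? zero
... | yes _ | yes _ = cong suc (count-split (P? ∘ suc) (Q? ∘ suc))
... | yes _ | no _  = trans (cong suc (count-split (P? ∘ suc) (Q? ∘ suc))) (sym (+-suc _ _))
... | no _  | _     = count-split (P? ∘ suc) (Q? ∘ suc)

count-singleton : {P : Pred (Fin n) ℓ} (P? : Decidable P) (z : Fin n) → count (P? ∩? (_≟ z)) ≡ indicator (P? z)
count-singleton {suc n} P? zero =
  trans (cong₂ _+_ (indicator-cong proj₁ (_, refl) (P? zero ×-dec (zero ≟ zero)) (P? zero))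
                   (count-empty ((P? ∘ suc) ∩? (λ x → suc x ≟ zero)) λ { _ (_ , ()) }))
        (+-identityʳ _)
count-singleton {suc n} P? (suc z) =
  cong₂ _+_ (indicator-no (λ { (_ , ()) }) (P? zero ×-dec (zero ≟ suc z)))
            (trans (count-cong _ ((P? ∘ suc) ∩? (_≟ z)) (λ (p , e) → p , suc-injective e) (λ (p , e) → p , cong suc e))
                   (count-singleton (P? ∘ suc) z))

count-point : {P : Pred (Fin n) ℓ} (P? : Decidable P) (z : Fin n) →
              count P? ≡ indicator (P? z) + count (P? ∩? ∁? (_≟ z))
count-point P? z = trans (count-split P? (_≟ z)) (cong (_+ count (P? ∩? ∁? (_≟ z))) (count-singleton P? z))

count-≤1 : {P : Pred (Fin n) ℓ} (P? : Decidable P) → (∀ {x y} → P x → P y → x ≡ y) → count P? ≤ 1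
count-≤1 {zero}  P? unique = z≤n
count-≤1 {suc n} P? unique with P? zero
... | yes p0 = ≤-reflexive (cong suc (count-empty (P? ∘ suc) λ x px → Finₚ.0≢1+n (unique p0 px)))
... | no _   = count-≤1 (P? ∘ suc) λ px py → suc-injective (unique px py)

count-pigeonhole : {P : Pred (Fin n) ℓ} (P? : Decidable P) (f : Fin n → ℕ) (q : ℕ) →
                   (∀ {x} → P x → f x < q) → (∀ {x y} → P x → P y → f x ≡ f y → x ≡ y) →
                   count P? ≤ q
count-pigeonhole P? f zero f<q f-inj = ≤-reflexive (count-empty P? λ x px → n≮0 (f<q px))
count-pigeonhole {P = P} P? f (suc q) f<q f-inj = begin
  count P?                                       ≡⟨ count-split P? below ⟩
  count (P? ∩? below) + count (P? ∩? ∁? below)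
    ≤⟨ +-mono-≤ (count-pigeonhole (P? ∩? below) f q proj₂ λ (px , _) (py , _) → f-inj px py)
                (count-≤1 (P? ∩? ∁? below) λ (px , ¬x<q) (py , ¬y<q) →
                   f-inj px py (trans (f≡q px ¬x<q) (sym (f≡q py ¬y<q)))) ⟩
  q + 1                                          ≡⟨ +-comm q 1 ⟩
  suc q                                          ∎
  where
  open ≤-Reasoning
  below = λ x → f x <? q
  f≡q : ∀ {x} → P x → ¬ f x < q → f x ≡ q
  f≡q px ¬x<q = ≤-antisym (s≤s⁻¹ (f<q px)) (≮⇒≥ ¬x<q)

∣p∣≡count : (S : Subset n) → ∣ S ∣ ≡ count (_∈? S)
∣p∣≡count []            = refl
∣p∣≡count (inside ∷ S)  = cong suc (trans (∣p∣≡count S) (count-cong (_∈? S) _ there drop-there))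
∣p∣≡count (outside ∷ S) = trans (∣p∣≡count S) (count-cong (_∈? S) _ there drop-there)

toSubset : {P : Pred (Fin n) ℓ} → Decidable P → Subset n
toSubset P? = tabulate (λ x → ⌊ P? x ⌋)

module _ {P : Pred (Fin n) ℓ} (P? : Decidable P) where

  ∈-toSubset⁺ : ∀ {x} → P x → x ∈ toSubset P?
  ∈-toSubset⁺ {x} px with P? x | lookup∘tabulate (λ x → ⌊ P? x ⌋) x
  ... | yes _  | eq = lookup⇒[]= x _ eq
  ... | no ¬px | _  = contradiction px ¬px

  ∈-toSubset⁻ : ∀ {x} → x ∈ toSubset P? → P x
  ∈-toSubset⁻ {x} x∈ with P? x | trans (sym (lookup∘tabulate (λ x → ⌊ P? x ⌋) x)) ([]=⇒lookup x∈)
  ... | yes px | _ = px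
  ... | no _   | ()

  ∣toSubset∣≡count : ∣ toSubset P? ∣ ≡ count P?
  ∣toSubset∣≡count = trans (∣p∣≡count (toSubset P?)) (count-cong _ P? ∈-toSubset⁻ ∈-toSubset⁺)

x∈p─q⇒x∉q : ∀ (p q : Subset n) {x} → x ∈ p ─ q → x ∉ q
x∈p─q⇒x∉q (inside ∷ p) (outside ∷ q) here          ()
x∈p─q⇒x∉q (_      ∷ p) (_       ∷ q) (there x∈p─q) (there x∈q) = x∈p─q⇒x∉q p q x∈p─q x∈q

count-swap : {T : Pred (Fin n) ℓ} (T? : Decidable T) (S : Subset n) {x y : Fin n} → x ∈ S → y ∉ S →
             count (T? ∩? (_∈? (S - x) ∪ ⁅ y ⁆)) + indicator (T? x) ≡ count (T? ∩? (_∈? S)) + indicator (T? y)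
count-swap T? S {x} {y} x∈S y∉S = begin
  count T∩S′? + indicator (T? x)                                      ≡⟨ cong (_+ indicator (T? x)) (count-point T∩S′? y) ⟩
  indicator (T∩S′? y) + count (T∩S′? ∩? ∁? (_≟ y)) + indicator (T? x)
    ≡⟨ cong₂ (λ a b → a + b + indicator (T? x)) (indicator-cong proj₁ (_, y∈S′) (T∩S′? y) (T? y)) others ⟩
  indicator (T? y) + count (T∩S? ∩? ∁? (_≟ x)) + indicator (T? x)     ≡⟨ swap-outer (indicator (T? y)) _ _ ⟩
  indicator (T? x) + count (T∩S? ∩? ∁? (_≟ x)) + indicator (T? y)
    ≡⟨ cong (λ a → a + count (T∩S? ∩? ∁? (_≟ x)) + indicator (T? y)) (indicator-cong (_, x∈S) proj₁ (T? x) (T∩S? x)) ⟩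
  indicator (T∩S? x) + count (T∩S? ∩? ∁? (_≟ x)) + indicator (T? y)   ≡⟨ cong (_+ indicator (T? y)) (count-point T∩S? x) ⟨
  count T∩S? + indicator (T? y)                                       ∎
  where
  open ≡-Reasoning
  S′ = (S - x) ∪ ⁅ y ⁆
  T∩S′? = T? ∩? (_∈? S′)
  T∩S? = T? ∩? (_∈? S)
  y∈S′ : y ∈ S′
  y∈S′ = x∈p∪q⁺ (inj₂ (x∈⁅x⁆ y))
  swap-outer : ∀ a b c → a + b + c ≡ c + b + a
  swap-outer = solve-∀
  others : count (T∩S′? ∩? ∁? (_≟ y)) ≡ count (T∩S? ∩? ∁? (_≟ x))
  others = count-cong (T∩S′? ∩? ∁? (_≟ y)) (T∩S? ∩? ∁? (_≟ x))
    (λ ((tz , z∈S′) , z≢y) → case x∈p∪q⁻ (S - x) ⁅ y ⁆ z∈S′ of λ where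
      (inj₁ z∈S-x) → (tz , p─q⊆p S ⁅ x ⁆ z∈S-x) , x∈p─q⇒x∉q S ⁅ x ⁆ z∈S-x ∘ (λ { refl → x∈⁅x⁆ x })
      (inj₂ z∈⁅y⁆) → contradiction (x∈⁅y⁆⇒x≡y y z∈⁅y⁆) z≢y)
    (λ ((tz , z∈S) , z≢x) → (tz , x∈p∪q⁺ (inj₁ (x∈p∧x≢y⇒x∈p-y z∈S z≢x))) , λ { refl → y∉S z∈S })

x∈⋂⁺ : ∀ {x} (L : List (Subset n)) → All (x ∈_) L → x ∈ ⋂ L
x∈⋂⁺ []      []          = ∈⊤
x∈⋂⁺ (S ∷ L) (x∈S ∷ x∈L) = x∈p∩q⁺ (x∈S , x∈⋂⁺ L x∈L)

x∈⋂⁻ : ∀ {x} (L : List (Subset n)) → x ∈ ⋂ L → All (x ∈_) L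
x∈⋂⁻ []      _   = []
x∈⋂⁻ (S ∷ L) x∈⋂ = let x∈S , x∈⋂L = x∈p∩q⁻ S (⋂ L) x∈⋂ in x∈S ∷ x∈⋂⁻ L x∈⋂L

⋂≡⊥⇒Any∉ : (L : List (Subset n)) → ⋂ L ≡ ⊥ → ∀ x → Any (x ∉_) L
⋂≡⊥⇒Any∉ L ⋂L≡⊥ x = All.¬All⇒Any¬ (x ∈?_) L λ x∈L → ∉⊥ (subst (x ∈_) ⋂L≡⊥ (x∈⋂⁺ L x∈L))

Any∉⇒⋂≡⊥ : (L : List (Subset n)) → (∀ x → Any (x ∉_) L) → ⋂ L ≡ ⊥
Any∉⇒⋂≡⊥ L escape = ⊆-antisym (λ {x} x∈⋂ → contradiction (x∈⋂⁻ L x∈⋂) (All.Any¬⇒¬All (escape x))) ⊥⊆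

count-union-bound : {T : Pred (Fin n) ℓ} (T? : Decidable T) (L : List (Subset n)) {q : ℕ} →
                    (∀ {x} → T x → Any (x ∉_) L) → All (λ S → count (T? ∩? ∁? (_∈? S)) ≤ q) L →
                    count T? ≤ length L * q
count-union-bound T? []      escape []               = ≤-reflexive (count-empty T? λ _ tx → case escape tx of λ ())
count-union-bound T? (S ∷ L) {q} escape (bound ∷ bounds) = begin
  count T?                                          ≡⟨ count-split T? (_∈? S) ⟩
  count (T? ∩? (_∈? S)) + count (T? ∩? ∁? (_∈? S))  ≤⟨ +-mono-≤ rest bound ⟩
  length L * q + q                                  ≡⟨ +-comm _ q ⟩
  q + length L * q                                  ∎
  where
  open ≤-Reasoning
  rest : count (T? ∩? (_∈? S)) ≤ length L * q
  rest = count-union-bound (T? ∩? (_∈? S)) L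
           (λ (tx , x∈S) → Any.tail (λ x∉S → x∉S x∈S) (escape tx))
           (All.map (λ {S′} → ≤-trans (count-mono ((T? ∩? (_∈? S)) ∩? ∁? (_∈? S′)) (T? ∩? ∁? (_∈? S′))
                                                   λ ((tx , _) , x∉S′) → tx , x∉S′)) bounds)

module Rank {ℓ₁ ℓ₂} {_≈_ : Rel (Fin n) ℓ₁} {_≺_ : Rel (Fin n) ℓ₂} (sto : IsStrictTotalOrder _≈_ _≺_) where
  open IsStrictTotalOrder sto using (compare; irrefl; module Eq) renaming (_<?_ to _≺?_; trans to ≺-trans)

  rank : Fin n → ℕ
  rank x = count (_≺? x)

  rank-mono : ∀ {x y} → x ≺ y → rank x < rank y
  rank-mono {x} {y} x≺y = count-⊂ (_≺? x) (_≺? y) (λ z≺x → ≺-trans z≺x x≺y) x≺y (irrefl Eq.refl)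

  rank-injective : ∀ {x y} → rank x ≡ rank y → x ≈ y
  rank-injective {x} {y} eq with compare x y
  ... | tri< x≺y _ _ = contradiction eq (<⇒≢ (rank-mono x≺y))
  ... | tri≈ _ x≈y _ = x≈y
  ... | tri> _ _ y≺x = contradiction (sym eq) (<⇒≢ (rank-mono y≺x))

  rank<count : ∀ {ℓ} {D : Pred (Fin n) ℓ} (D? : Decidable D) → (∀ {y z} → y ≺ z → D z → D y) →
               ∀ {x} → D x → rank x < count D?
  rank<count D? down {x} Dx = count-⊂ (_≺? x) D? (λ y≺x → down y≺x Dx) Dx (irrefl Eq.refl)

-- Prefix sums, maxima and ceiling division

sumFirst-zero : (f : Fin t → ℕ) → sumFirst f 0 ≡ 0
sumFirst-zero {zero}  f = refl
sumFirst-zero {suc t} f = refl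

sumFirst-snoc : (f : Fin t → ℕ) (a : Fin t) → sumFirst f (suc (toℕ a)) ≡ sumFirst f (toℕ a) + f a
sumFirst-snoc f zero    = trans (cong (f zero +_) (sumFirst-zero (λ j → f (suc j)))) (+-comm (f zero) 0)
sumFirst-snoc f (suc a) = trans (cong (f zero +_) (sumFirst-snoc (λ j → f (suc j)) a)) (sym (+-assoc (f zero) _ _))

sumFirst-cong : {f g : Fin t → ℕ} → (∀ a → f a ≡ g a) → ∀ k → sumFirst f k ≡ sumFirst g k
sumFirst-cong {zero}  f≡g k       = refl
sumFirst-cong {suc t} f≡g zero    = refl
sumFirst-cong {suc t} f≡g (suc k) = cong₂ _+_ (f≡g zero) (sumFirst-cong (λ a → f≡g (suc a)) k)

sumFirst-∸ : (f g : Fin t → ℕ) → (∀ a → g a ≤ f a) → ∀ k →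
             sumFirst (λ a → f a ∸ g a) k + sumFirst g k ≡ sumFirst f k
sumFirst-∸ {zero}  f g g≤f k       = refl
sumFirst-∸ {suc t} f g g≤f zero    = refl
sumFirst-∸ {suc t} f g g≤f (suc k) = begin
  (f zero ∸ g zero + sumFirst (λ a → f (suc a) ∸ g (suc a)) k) + (g zero + sumFirst (λ a → g (suc a)) k)
    ≡⟨ interchange (f zero ∸ g zero) _ (g zero) _ ⟩
  (f zero ∸ g zero + g zero) + (sumFirst (λ a → f (suc a) ∸ g (suc a)) k + sumFirst (λ a → g (suc a)) k)
    ≡⟨ cong₂ _+_ (m∸n+n≡m (g≤f zero)) (sumFirst-∸ (λ a → f (suc a)) (λ a → g (suc a)) (λ a → g≤f (suc a)) k) ⟩
  f zero + sumFirst (λ a → f (suc a)) k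
    ∎
  where open ≡-Reasoning

sumFirst-≥ : (f : Fin t → ℕ) → (∀ a → 1 ≤ f a) → ∀ k → k ≤ t → k ≤ sumFirst f k
sumFirst-≥ {zero}  f 1≤f zero    _         = z≤n
sumFirst-≥ {suc t} f 1≤f zero    _         = z≤n
sumFirst-≥ {suc t} f 1≤f (suc k) (s≤s k≤t) =
  +-mono-≤ (1≤f zero) (sumFirst-≥ (λ a → f (suc a)) (λ a → 1≤f (suc a)) k k≤t)

-- The entries after the first s sum to at least 2 (t − s) − 1; stated without subtraction.
sumFirst-gap : (f : Fin t → ℕ) → (∀ a → 1 ≤ f a) → (∀ a → suc (toℕ a) < t → 2 ≤ f a) →
               ∀ s → s ≤ t → sumFirst f s + 2 * t ≤ sumFirst f t + 2 * s + 1
sumFirst-gap {zero}        f 1≤f 2≤f zero    _ = z≤n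
sumFirst-gap {suc zero}    f 1≤f 2≤f zero    _ = +-monoˡ-≤ 1 (≤-trans (1≤f zero) (≤-trans (m≤m+n _ 0) (m≤m+n _ 0)))
sumFirst-gap {suc (suc t)} f 1≤f 2≤f zero    _ = begin
  2 * suc (suc t)                            ≡⟨ shuffle t ⟩
  2 + (0 + 2 * suc t)
    ≤⟨ +-mono-≤ (2≤f zero (s≤s (s≤s z≤n))) (sumFirst-gap f′ 1≤f′ 2≤f′ zero z≤n) ⟩
  f zero + (sumFirst f′ (suc t) + 0 + 1)     ≡⟨ shuffle′ (f zero) _ ⟩
  f zero + sumFirst f′ (suc t) + 0 + 1       ∎
  where
  open ≤-Reasoning
  f′ = λ a → f (suc a)
  1≤f′ = λ a → 1≤f (suc a)
  2≤f′ = λ a lt → 2≤f (suc a) (s≤s lt)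
  shuffle : ∀ t → 2 * suc (suc t) ≡ 2 + (0 + 2 * suc t)
  shuffle = solve-∀
  shuffle′ : ∀ a b → a + (b + 0 + 1) ≡ a + b + 0 + 1
  shuffle′ = solve-∀
sumFirst-gap {suc t} f 1≤f 2≤f (suc s) (s≤s s≤t) = begin
  f zero + sumFirst f′ s + 2 * suc t         ≡⟨ shuffle (f zero) (sumFirst f′ s) t ⟩
  f zero + 2 + (sumFirst f′ s + 2 * t)       ≤⟨ +-monoʳ-≤ (f zero + 2) (sumFirst-gap f′ 1≤f′ 2≤f′ s s≤t) ⟩
  f zero + 2 + (sumFirst f′ t + 2 * s + 1)   ≡⟨ shuffle′ (f zero) (sumFirst f′ t) s ⟩
  f zero + sumFirst f′ t + 2 * suc s + 1     ∎
  where
  open ≤-Reasoning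
  f′ = λ a → f (suc a)
  1≤f′ = λ a → 1≤f (suc a)
  2≤f′ = λ a lt → 2≤f (suc a) (s≤s lt)
  shuffle : ∀ a b t → a + b + 2 * suc t ≡ a + 2 + (b + 2 * t)
  shuffle = solve-∀
  shuffle′ : ∀ a b s → a + 2 + (b + 2 * s + 1) ≡ a + b + 2 * suc s + 1
  shuffle′ = solve-∀

prefix-first : (f : Fin t → ℕ) {a : Fin t} → toℕ a ≡ 0 → prefix f a ≡ f a
prefix-first f {a} toℕa≡0 = begin
  prefix f a                ≡⟨ sumFirst-snoc f a ⟩
  sumFirst f (toℕ a) + f a  ≡⟨ cong (λ k → sumFirst f k + f a) toℕa≡0 ⟩
  sumFirst f 0 + f a        ≡⟨ cong (_+ f a) (sumFirst-zero f) ⟩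
  f a                       ∎
  where open ≡-Reasoning

prefix-next : (f : Fin t → ℕ) {a b : Fin t} → toℕ a ≡ suc (toℕ b) → prefix f a ≡ prefix f b + f a
prefix-next f {a} a≡b+1 = trans (sumFirst-snoc f a) (cong (λ k → sumFirst f k + f a) a≡b+1)

⪯⇒sumFirst-≤ : {u v : Fin t → ℕ} → u ⪯ v → ∀ k → k ≤ t → sumFirst u k ≤ sumFirst v k
⪯⇒sumFirst-≤ {u = u} {v} u⪯v zero    _   = ≤-reflexive (trans (sumFirst-zero u) (sym (sumFirst-zero v)))
⪯⇒sumFirst-≤ {u = u} {v} u⪯v (suc k) k<t =
  subst₂ (λ i j → sumFirst u (suc i) ≤ sumFirst v (suc j)) (toℕ-fromℕ< k<t) (toℕ-fromℕ< k<t) (u⪯v (fromℕ< k<t))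

maxFin-lub : ∀ t (f : Fin t → ℕ) {k} → (∀ i → f i ≤ k) → maxFin t f ≤ k
maxFin-lub zero    f f≤k = z≤n
maxFin-lub (suc t) f f≤k = ⊔-lub (f≤k zero) (maxFin-lub t (λ i → f (suc i)) (λ i → f≤k (suc i)))

maxFin-ub : ∀ t (f : Fin t → ℕ) i → f i ≤ maxFin t f
maxFin-ub (suc t) f zero    = m≤m⊔n _ _
maxFin-ub (suc t) f (suc i) = ≤-trans (maxFin-ub t (λ j → f (suc j)) i) (m≤n⊔m _ _)

maxFin-mono : ∀ t {f g : Fin t → ℕ} → (∀ i → f i ≤ g i) → maxFin t f ≤ maxFin t g
maxFin-mono t {f} {g} f≤g = maxFin-lub t f (λ i → ≤-trans (f≤g i) (maxFin-ub t g i))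

ceilDiv-least : ∀ a b {k} → 0 < b → a ≤ k * b → ceilDiv a b ≤ k
ceilDiv-least a (suc b) {k} _ a≤kb = s≤s⁻¹ (m<n*o⇒m/o<n (begin-strict
  a + b              ≤⟨ +-monoˡ-≤ b a≤kb ⟩
  k * suc b + b      <⟨ +-monoʳ-< (k * suc b) (n<1+n b) ⟩
  k * suc b + suc b  ≡⟨ +-comm (k * suc b) (suc b) ⟩
  suc k * suc b      ∎))
  where open ≤-Reasoning

ceilDiv-lower : ∀ a b → 0 < b → a ≤ ceilDiv a b * b
ceilDiv-lower a (suc b) _ = +-cancelʳ-≤ b a _ (begin
  a + b                                      ≡⟨ m≡m%n+[m/n]*n (a + b) (suc b) ⟩
  (a + b) % suc b + (a + b) / suc b * suc b  ≤⟨ +-monoˡ-≤ _ (s≤s⁻¹ (m%n<n (a + b) (suc b))) ⟩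
  b + (a + b) / suc b * suc b                ≡⟨ +-comm b _ ⟩
  (a + b) / suc b * suc b + b                ∎)
  where open ≤-Reasoning

ceilDiv-antitone : ∀ a {b b′} → 0 < b → b ≤ b′ → ceilDiv a b′ ≤ ceilDiv a b
ceilDiv-antitone a {b} {b′} 0<b b≤b′ =
  ceilDiv-least a b′ (<-≤-trans 0<b b≤b′) (≤-trans (ceilDiv-lower a b 0<b) (*-monoʳ-≤ (ceilDiv a b) b≤b′))

ceilDiv-pos : ∀ a b → 0 < b → b ≤ a → 0 < ceilDiv a b
ceilDiv-pos a b 0<b b≤a with ceilDiv a b | ceilDiv-lower a b 0<b
... | zero  | a≤0 = contradiction (≤-trans 0<b (≤-trans b≤a a≤0)) λ ()
... | suc _ | _   = s≤s z≤n

m+2≤o+2n⇒m≤o*n : ∀ m o n → 0 < n → 2 ≤ o → m + 2 ≤ o + 2 * n → m ≤ o * n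
m+2≤o+2n⇒m≤o*n m o (suc n) _ 2≤o m+2≤o+2n = begin
  m          ≤⟨ +-cancelʳ-≤ 2 m (o + 2 * n) (≤-trans m+2≤o+2n (≤-reflexive (shuffle o n))) ⟩
  o + 2 * n  ≤⟨ +-monoʳ-≤ o (*-monoˡ-≤ n 2≤o) ⟩
  o + o * n  ≡⟨ *-suc o n ⟨
  o * suc n  ∎
  where
  open ≤-Reasoning
  shuffle : ∀ o n → o + 2 * suc n ≡ o + 2 * n + 2
  shuffle = solve-∀

ceilDiv-≤-2⊔ : ∀ P N t s → 0 < s → P + 2 * t ≤ N + 2 * s + 1 → ceilDiv P s ≤ 2 ⊔ (N + 3 ∸ 2 * t)
ceilDiv-≤-2⊔ P N t s 0<s gap = ceilDiv-least P s 0<s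
  (m+2≤o+2n⇒m≤o*n P (2 ⊔ X) s 0<s (m≤m⊔n 2 X) (≤-trans P+2≤X+2s (+-monoˡ-≤ (2 * s) (m≤n⊔m 2 X))))
  where
  X = N + 3 ∸ 2 * t
  P+2≤X+2s : P + 2 ≤ X + 2 * s
  P+2≤X+2s = +-cancelˡ-≤ (2 * t) _ _ (begin
    2 * t + (P + 2)      ≡⟨ shuffle P t ⟩
    P + 2 * t + 2        ≤⟨ +-monoˡ-≤ 2 gap ⟩
    N + 2 * s + 1 + 2    ≡⟨ shuffle′ N s ⟩
    N + 3 + 2 * s        ≤⟨ +-monoˡ-≤ (2 * s) (m≤n+m∸n (N + 3) (2 * t)) ⟩
    2 * t + X + 2 * s    ≡⟨ +-assoc (2 * t) X (2 * s) ⟩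
    2 * t + (X + 2 * s)  ∎)
    where
    open ≤-Reasoning
    shuffle : ∀ P t → 2 * t + (P + 2) ≡ P + 2 * t + 2
    shuffle = solve-∀
    shuffle′ : ∀ N s → N + 2 * s + 1 + 2 ≡ N + 3 + 2 * s
    shuffle′ = solve-∀

-- Players grouped by class

module _ {n t : ℕ} (c : Fin n → Fin t) where

  classBelow? : (k : ℕ) → Decidable (λ p → toℕ (c p) < k)
  classBelow? k p = toℕ (c p) <? k

  upTo? : (i : Fin t) → Decidable (λ p → c p ≤ᶠ i)
  upTo? i p = c p ≤? i

  coalVec-count : ∀ (S : Subset n) a → coalVec c S a ≡ count ((λ p → c p ≟ a) ∩? (_∈? S))
  coalVec-count S a = trans (∣p∣≡count (S ∩ classSet c a))
    (count-cong (_∈? (S ∩ classSet c a)) ((λ p → c p ≟ a) ∩? (_∈? S))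
      (λ p∈ → let p∈S , p∈N = x∈p∩q⁻ S (classSet c a) p∈ in ∈-toSubset⁻ (λ p → c p ≟ a) p∈N , p∈S)
      (λ (cp≡a , p∈S) → x∈p∩q⁺ (p∈S , ∈-toSubset⁺ (λ p → c p ≟ a) cp≡a)))

  classSize-count : ∀ a → classSize c a ≡ count (λ p → c p ≟ a)
  classSize-count a = ∣toSubset∣≡count (λ p → c p ≟ a)

  coalVec≤classSize : ∀ (S : Subset n) a → coalVec c S a ≤ classSize c a
  coalVec≤classSize S a = subst₂ _≤_ (sym (coalVec-count S a)) (sym (classSize-count a))
    (count-mono ((λ p → c p ≟ a) ∩? (_∈? S)) (λ p → c p ≟ a) proj₁)

  coalVec<classSize : ∀ (S : Subset n) {y a} → y ∉ S → c y ≡ a → coalVec c S a < classSize c a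
  coalVec<classSize S {y} {a} y∉S cy≡a = subst₂ _<_ (sym (coalVec-count S a)) (sym (classSize-count a))
    (count-⊂ ((λ p → c p ≟ a) ∩? (_∈? S)) (λ p → c p ≟ a) proj₁ cy≡a (y∉S ∘ proj₂))

  coalVec-pos : ∀ (S : Subset n) {x a} → x ∈ S → c x ≡ a → 0 < coalVec c S a
  coalVec-pos S {x} {a} x∈S cx≡a =
    subst (0 <_) (sym (coalVec-count S a)) (count-pos ((λ p → c p ≟ a) ∩? (_∈? S)) (cx≡a , x∈S))

  sumFirst-fibres : ∀ {P : Pred (Fin n) ℓ} (P? : Decidable P) k → k ≤ t →
                    sumFirst (λ a → count ((λ p → c p ≟ a) ∩? P?)) k ≡ count (classBelow? k ∩? P?)
  sumFirst-fibres P? zero _ =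
    trans (sumFirst-zero (λ a → count ((λ p → c p ≟ a) ∩? P?)))
          (sym (count-empty (classBelow? 0 ∩? P?) λ _ (lt , _) → n≮0 lt))
  sumFirst-fibres P? (suc k) k<t = begin
    sumFirst fibre (suc k)                                  ≡⟨ cong (λ j → sumFirst fibre (suc j)) (sym toℕa≡k) ⟩
    sumFirst fibre (suc (toℕ a))                            ≡⟨ sumFirst-snoc fibre a ⟩
    sumFirst fibre (toℕ a) + fibre a                        ≡⟨ cong (λ j → sumFirst fibre j + fibre a) toℕa≡k ⟩
    sumFirst fibre k + fibre a                              ≡⟨ cong₂ _+_ (trans (sumFirst-fibres P? k (<⇒≤ k<t)) earlier) latest ⟩
    count (below+1 ∩? below) + count (below+1 ∩? ∁? below)  ≡⟨ count-split below+1 below ⟨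
    count below+1                                           ∎
    where
    open ≡-Reasoning
    fibre = λ a → count ((λ p → c p ≟ a) ∩? P?)
    below = classBelow? k
    below+1 = classBelow? (suc k) ∩? P?
    a = fromℕ< k<t
    toℕa≡k : toℕ a ≡ k
    toℕa≡k = toℕ-fromℕ< k<t
    earlier : count (below ∩? P?) ≡ count (below+1 ∩? below)
    earlier = count-cong (below ∩? P?) (below+1 ∩? below)
      (λ (lt , Pp) → (m<n⇒m<1+n lt , Pp) , lt) (λ ((_ , Pp) , lt) → lt , Pp)
    latest : fibre a ≡ count (below+1 ∩? ∁? below)
    latest = count-cong ((λ p → c p ≟ a) ∩? P?) (below+1 ∩? ∁? below)
      (λ (cp≡a , Pp) → let cp≡k = trans (cong toℕ cp≡a) toℕa≡k in
                        (≤-reflexive (cong suc cp≡k) , Pp) , <-irrefl cp≡k)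
      (λ ((lt , Pp) , ¬lt) → toℕ-injective (trans (≤-antisym (s≤s⁻¹ lt) (≮⇒≥ ¬lt)) (sym toℕa≡k)) , Pp)

  sumFirst-coalVec : ∀ (S : Subset n) k → k ≤ t → sumFirst (coalVec c S) k ≡ count (classBelow? k ∩? (_∈? S))
  sumFirst-coalVec S k k≤t = trans (sumFirst-cong (coalVec-count S) k) (sumFirst-fibres (_∈? S) k k≤t)

  sumFirst-classSize : ∀ k → k ≤ t → sumFirst (classSize c) k ≡ count (classBelow? k)
  sumFirst-classSize k k≤t = begin
    sumFirst (classSize c) k          ≡⟨ sumFirst-cong (λ a → cong ∣_∣ (sym (∩-identityˡ (classSet c a)))) k ⟩
    sumFirst (coalVec c ⊤) k          ≡⟨ sumFirst-coalVec ⊤ k k≤t ⟩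
    count (classBelow? k ∩? (_∈? ⊤))  ≡⟨ count-cong (classBelow? k ∩? (_∈? ⊤)) (classBelow? k) proj₁ (_, ∈⊤) ⟩
    count (classBelow? k)             ∎
    where open ≡-Reasoning

  sumFirst-classSize-all : sumFirst (classSize c) t ≡ n
  sumFirst-classSize-all = trans (sumFirst-classSize t ≤-refl)
    (trans (count-cong (classBelow? t) U? _ (λ {p} _ → toℕ<n (c p))) count-U)

  prefix-coalVec : ∀ (S : Subset n) i → prefix (coalVec c S) i ≡ count (upTo? i ∩? (_∈? S))
  prefix-coalVec S i = trans (sumFirst-coalVec S (suc (toℕ i)) (toℕ<n i))
    (count-cong (classBelow? (suc (toℕ i)) ∩? (_∈? S)) (upTo? i ∩? (_∈? S))
      (λ (lt , p∈S) → s≤s⁻¹ lt , p∈S) (λ (le , p∈S) → s≤s le , p∈S))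

  prefix-classSize : ∀ i → prefix (classSize c) i ≡ count (upTo? i)
  prefix-classSize i = trans (sumFirst-classSize (suc (toℕ i)) (toℕ<n i))
    (count-cong (classBelow? (suc (toℕ i))) (upTo? i) s≤s⁻¹ s≤s)

  missing : Subset n → Fin t → ℕ
  missing S i = count (upTo? i ∩? ∁? (_∈? S))

  prefix-coalVec+missing : ∀ (S : Subset n) i → prefix (coalVec c S) i + missing S i ≡ prefix (classSize c) i
  prefix-coalVec+missing S i = begin
    prefix (coalVec c S) i + missing S i         ≡⟨ cong (_+ missing S i) (prefix-coalVec S i) ⟩
    count (upTo? i ∩? (_∈? S)) + missing S i     ≡⟨ count-split (upTo? i) (_∈? S) ⟨
    count (upTo? i)                              ≡⟨ prefix-classSize i ⟨
    prefix (classSize c) i                       ∎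
    where open ≡-Reasoning

  private
    byClass : Fin n → Fin t × Fin n
    byClass p = c p , p

  _≺_ : Rel (Fin n) 0ℓ
  _≺_ = ×-Lex _≡_ _<ᶠ_ _<ᶠ_ on byClass

  ≺-isStrictTotalOrder : IsStrictTotalOrder (Pointwise _≡_ _≡_ on byClass) _≺_
  ≺-isStrictTotalOrder = On.isStrictTotalOrder byClass
    (×-isStrictTotalOrder Finₚ.<-isStrictTotalOrder Finₚ.<-isStrictTotalOrder)

  -- The position of p when the players are listed class by class.
  open Rank ≺-isStrictTotalOrder public using () renaming (rank to position)

  position-injective : ∀ {p q} → position p ≡ position q → p ≡ q
  position-injective = proj₂ ∘ Rank.rank-injective ≺-isStrictTotalOrder

  position<prefix-classSize : ∀ {p i} → c p ≤ᶠ i → position p < prefix (classSize c) i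
  position<prefix-classSize {i = i} cp≤i = subst (_ <_) (sym (prefix-classSize i))
    (Rank.rank<count ≺-isStrictTotalOrder (upTo? i) down-closed cp≤i)
    where
    down-closed : ∀ {q p} → q ≺ p → c p ≤ᶠ i → c q ≤ᶠ i
    down-closed (inj₁ cq<cp)       cp≤i = <⇒≤ (<-≤-trans cq<cp cp≤i)
    down-closed (inj₂ (cq≡cp , _)) cp≤i = subst (_≤ᶠ i) (sym cq≡cp) cp≤i

-- Games with a unique shift-minimal winning vector

module Game {n t : ℕ} {W : Subset n → Bool} {c : Fin n → Fin t} {m : Fin t → ℕ}
            (ordered : OrderedClasses W c) (unique : UniqueSMW W c m) where

  win⇒m⪯ : ∀ {S} → Win W S → m ⪯ coalVec c S
  win⇒m⪯ {S} = Equivalence.to (proj₂ unique S)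

  m⪯⇒win : ∀ {S} → m ⪯ coalVec c S → Win W S
  m⪯⇒win {S} = Equivalence.from (proj₂ unique S)

  m≤classSize : ∀ a → m a ≤ classSize c a
  m≤classSize a = let (S , S≡m , _) , _ = proj₁ unique in subst (_≤ classSize c a) (S≡m a) (coalVec≤classSize c S a)

  classMember : ∀ a → Σ (Fin n) (λ x → c x ≡ a)
  classMember a = let x , c⁻¹a = proj₁ ordered a in x , c⁻¹a refl

  size slack : Fin t → ℕ
  size  = prefix (classSize c)
  slack = prefix (λ j → classSize c j ∸ m j)

  slack+m≡size : ∀ i → slack i + prefix m i ≡ size i
  slack+m≡size i = sumFirst-∸ (classSize c) m m≤classSize (suc (toℕ i))

  win⇒missing≤slack : ∀ {S} → Win W S → ∀ i → missing c S i ≤ slack i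
  win⇒missing≤slack {S} win i = +-cancelʳ-≤ (prefix m i) _ _ (begin
    missing c S i + prefix m i              ≤⟨ +-monoʳ-≤ (missing c S i) (win⇒m⪯ win i) ⟩
    missing c S i + prefix (coalVec c S) i  ≡⟨ +-comm (missing c S i) _ ⟩
    prefix (coalVec c S) i + missing c S i  ≡⟨ prefix-coalVec+missing c S i ⟩
    size i                                  ≡⟨ slack+m≡size i ⟨
    slack i + prefix m i                    ∎)
    where open ≤-Reasoning

  missing≤slack⇒win : ∀ {S} → (∀ i → missing c S i ≤ slack i) → Win W S
  missing≤slack⇒win {S} missing≤slack = m⪯⇒win λ i → +-cancelˡ-≤ (slack i) _ _ (begin
    slack i + prefix m i                    ≡⟨ slack+m≡size i ⟩
    size i                                  ≡⟨ prefix-coalVec+missing c S i ⟨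
    prefix (coalVec c S) i + missing c S i  ≤⟨ +-monoʳ-≤ _ (missing≤slack i) ⟩
    prefix (coalVec c S) i + slack i        ≡⟨ +-comm _ (slack i) ⟩
    slack i + prefix (coalVec c S) i        ∎)
    where open ≤-Reasoning

  -- Replacing x by y lowers only the b-th prefix sum of the coalition vector, by one.
  module _ {a b : Fin t} (a≡b+1 : toℕ a ≡ suc (toℕ b)) {x y : Fin n} (cx≡b : c x ≡ b) (cy≡a : c y ≡ a) where

    private
      cx≡b′ : toℕ (c x) ≡ toℕ b
      cx≡b′ = cong toℕ cx≡b

      cy≡b+1 : toℕ (c y) ≡ suc (toℕ b)
      cy≡b+1 = trans (cong toℕ cy≡a) a≡b+1

      x-in : ∀ {i} → toℕ b ≤ toℕ i → indicator (upTo? c i x) ≡ 1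
      x-in {i} b≤i = indicator-yes (subst (_≤ toℕ i) (sym cx≡b′) b≤i) (upTo? c i x)

      x-out : ∀ {i} → toℕ i < toℕ b → indicator (upTo? c i x) ≡ 0
      x-out {i} i<b = indicator-no (λ cx≤i → <⇒≱ i<b (subst (_≤ toℕ i) cx≡b′ cx≤i)) (upTo? c i x)

      y-in : ∀ {i} → toℕ b < toℕ i → indicator (upTo? c i y) ≡ 1
      y-in {i} b<i = indicator-yes (subst (_≤ toℕ i) (sym cy≡b+1) b<i) (upTo? c i y)

      y-out : ∀ {i} → toℕ i ≤ toℕ b → indicator (upTo? c i y) ≡ 0
      y-out {i} i≤b = indicator-no (λ cy≤i → ≤⇒≯ i≤b (subst (_≤ toℕ i) cy≡b+1 cy≤i)) (upTo? c i y)

    swap-desirable : (∀ {S} → Win W S → x ∈ S → y ∉ S → prefix m b < prefix (coalVec c S) b) → Desirable W y x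
    swap-desirable gain S x∈S y∉S win = m⪯⇒win m⪯S′
      where
      S′ = (S - x) ∪ ⁅ y ⁆
      swapped : ∀ i {j k} → indicator (upTo? c i x) ≡ j → indicator (upTo? c i y) ≡ k →
                prefix (coalVec c S′) i + j ≡ prefix (coalVec c S) i + k
      swapped i refl refl = subst₂ (λ u v → u + indicator (upTo? c i x) ≡ v + indicator (upTo? c i y))
        (sym (prefix-coalVec c S′ i)) (sym (prefix-coalVec c S i)) (count-swap (upTo? c i) S x∈S y∉S)
      unchanged : ∀ i {j} → indicator (upTo? c i x) ≡ j → indicator (upTo? c i y) ≡ j →
                  prefix m i ≤ prefix (coalVec c S′) i
      unchanged i x≡j y≡j = ≤-trans (win⇒m⪯ win i) (≤-reflexive (sym (+-cancelʳ-≡ _ _ _ (swapped i x≡j y≡j))))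
      m⪯S′ : m ⪯ coalVec c S′
      m⪯S′ i with Finₚ.<-cmp i b
      ... | tri< i<b _ _ = unchanged i (x-out i<b) (y-out (<⇒≤ i<b))
      ... | tri> _ _ b<i = unchanged i (x-in (<⇒≤ b<i)) (y-in b<i)
      ... | tri≈ _ refl _ = s≤s⁻¹ (begin-strict
        prefix m i                     <⟨ gain win x∈S y∉S ⟩
        prefix (coalVec c S) i         ≡⟨ +-identityʳ _ ⟨
        prefix (coalVec c S) i + 0     ≡⟨ swapped i (x-in ≤-refl) (y-out ≤-refl) ⟨
        prefix (coalVec c S′) i + 1    ≡⟨ +-comm _ 1 ⟩
        suc (prefix (coalVec c S′) i)  ∎)
        where open ≤-Reasoning

    no-swap-gain : ¬ (∀ {S} → Win W S → x ∈ S → y ∉ S → prefix m b < prefix (coalVec c S) b)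
    no-swap-gain gain = 1+n≰n (subst₂ _≤_ cy≡b+1 cx≡b′ (Equivalence.to (proj₂ ordered y x) (swap-desirable gain)))

  m<classSize : NoVetoer W → ∀ a → m a < classSize c a
  m<classSize noVeto a = ≰⇒> (classSize≰m a)
    where
    classSize≰m : ∀ a → ¬ classSize c a ≤ m a
    classSize≰m a n≤m with toℕ a in toℕa≡
    ... | zero = noVeto x veto
      where
      x = proj₁ (classMember a)
      veto : Vetoer W x
      veto S win with x ∈? S
      ... | yes x∈S = x∈S
      ... | no  x∉S = contradiction (begin
        classSize c a           ≤⟨ n≤m ⟩
        m a                     ≡⟨ prefix-first m toℕa≡ ⟨
        prefix m a              ≤⟨ win⇒m⪯ win a ⟩
        prefix (coalVec c S) a  ≡⟨ prefix-first (coalVec c S) toℕa≡ ⟩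
        coalVec c S a           ∎) (<⇒≱ (coalVec<classSize c S x∉S (proj₂ (classMember a))))
        where open ≤-Reasoning
    ... | suc k = no-swap-gain a≡b+1 (proj₂ (classMember b)) (proj₂ (classMember a)) gain
      where
      k<t : k < t
      k<t = <-trans (n<1+n k) (subst (_< t) toℕa≡ (toℕ<n a))
      b = fromℕ< k<t
      a≡b+1 : toℕ a ≡ suc (toℕ b)
      a≡b+1 = trans toℕa≡ (cong suc (sym (toℕ-fromℕ< k<t)))
      gain : ∀ {S} → Win W S → proj₁ (classMember b) ∈ S → proj₁ (classMember a) ∉ S → prefix m b < prefix (coalVec c S) b
      gain {S} win _ y∉S = +-cancelʳ-< (m a) _ _ (begin-strict
        prefix m b + m a                        ≡⟨ prefix-next m a≡b+1 ⟨
        prefix m a                              ≤⟨ win⇒m⪯ win a ⟩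
        prefix (coalVec c S) a                  ≡⟨ prefix-next (coalVec c S) a≡b+1 ⟩
        prefix (coalVec c S) b + coalVec c S a
          <⟨ +-monoʳ-< _ (<-≤-trans (coalVec<classSize c S y∉S (proj₂ (classMember a))) n≤m) ⟩
        prefix (coalVec c S) b + m a            ∎)
        where open ≤-Reasoning

  m-pos : ∀ b → suc (toℕ b) < t → 0 < m b
  m-pos b b+1<t with m b in mb≡0
  ... | suc _ = s≤s z≤n
  ... | zero  = ⊥-elim (no-swap-gain (toℕ-fromℕ< b+1<t) (proj₂ (classMember b)) (proj₂ (classMember a)) gain)
    where
    a = fromℕ< b+1<t
    gain : ∀ {S} → Win W S → proj₁ (classMember b) ∈ S → proj₁ (classMember a) ∉ S → prefix m b < prefix (coalVec c S) b
    gain {S} win x∈S _ = begin-strict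
      prefix m b                                      ≡⟨ sumFirst-snoc m b ⟩
      sumFirst m (toℕ b) + m b                        ≡⟨ cong (sumFirst m (toℕ b) +_) mb≡0 ⟩
      sumFirst m (toℕ b) + 0
        ≤⟨ +-monoˡ-≤ 0 (⪯⇒sumFirst-≤ (win⇒m⪯ win) (toℕ b) (<⇒≤ (toℕ<n b))) ⟩
      sumFirst (coalVec c S) (toℕ b) + 0              <⟨ +-monoʳ-< _ (coalVec-pos c S x∈S (proj₂ (classMember b))) ⟩
      sumFirst (coalVec c S) (toℕ b) + coalVec c S b  ≡⟨ sumFirst-snoc (coalVec c S) b ⟨
      prefix (coalVec c S) b                          ∎
      where open ≤-Reasoning

  size≤length*slack : ∀ L → All (Win W) L → ⋂ L ≡ ⊥ → ∀ i → size i ≤ length L * slack i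
  size≤length*slack L wins ⋂L≡⊥ i = subst (_≤ length L * slack i) (sym (prefix-classSize c i))
    (count-union-bound (upTo? c i) L (λ {x} _ → ⋂≡⊥⇒Any∉ L ⋂L≡⊥ x)
                                     (All.map (λ win → win⇒missing≤slack win i) wins))

  module _ (k : ℕ) .{{_ : NonZero k}} (size≤k*slack : ∀ i → size i ≤ k * slack i) where

    residue : Fin n → Fin k
    residue p = position c p mod k

    avoiding : Fin k → Subset n
    avoiding r = toSubset (∁? (λ p → residue p ≟ r))

    ∉avoiding⇒residue≡ : ∀ {p r} → p ∉ avoiding r → residue p ≡ r
    ∉avoiding⇒residue≡ {p} {r} p∉ = decidable-stable (residue p ≟ r) (p∉ ∘ ∈-toSubset⁺ (∁? (λ q → residue q ≟ r)))

    ∉avoiding-residue : ∀ p → p ∉ avoiding (residue p)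
    ∉avoiding-residue p p∈ = ∈-toSubset⁻ (∁? (λ q → residue q ≟ residue p)) p∈ refl

    residueClass≤slack : ∀ r i → count (upTo? c i ∩? (λ p → residue p ≟ r)) ≤ slack i
    residueClass≤slack r i = count-pigeonhole (upTo? c i ∩? (λ p → residue p ≟ r)) (λ p → position c p / k) (slack i)
      (λ (p≤i , _) → m<n*o⇒m/o<n (<-≤-trans (position<prefix-classSize c p≤i)
                                             (≤-trans (size≤k*slack i) (≤-reflexive (*-comm k (slack i))))))
      (λ {p} {q} (_ , p≡r) (_ , q≡r) p/k≡q/k → position-injective c (begin
        position c p                            ≡⟨ DivMod.property (position c p divMod k) ⟩
        toℕ (residue p) + position c p / k * k  ≡⟨ cong₂ (λ u v → toℕ u + v * k) (trans p≡r (sym q≡r)) p/k≡q/k ⟩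
        toℕ (residue q) + position c q / k * k  ≡⟨ DivMod.property (position c q divMod k) ⟨
        position c q                            ∎))
      where open ≡-Reasoning

    avoiding-wins : ∀ r → Win W (avoiding r)
    avoiding-wins r = missing≤slack⇒win λ i → ≤-trans
      (count-mono (upTo? c i ∩? ∁? (_∈? avoiding r)) (upTo? c i ∩? (λ p → residue p ≟ r))
                  (λ (p≤i , p∉) → p≤i , ∉avoiding⇒residue≡ p∉))
      (residueClass≤slack r i)

    avoiding-cover : Σ (List (Subset n)) λ L → length L ≡ k × All (Win W) L × ⋂ L ≡ ⊥
    avoiding-cover = List.tabulate avoiding , length-tabulate avoiding , All.tabulate⁺ avoiding-wins ,
                     Any∉⇒⋂≡⊥ (List.tabulate avoiding) (λ p → Any.tabulate⁺ (residue p) (∉avoiding-residue p))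

  module _ (noVeto : NoVetoer W) where

    slack-≥ : ∀ i → suc (toℕ i) ≤ slack i
    slack-≥ i = sumFirst-≥ (λ j → classSize c j ∸ m j) (λ j → m<n⇒0<n∸m (m<classSize noVeto j))
                           (suc (toℕ i)) (toℕ<n i)

    slack-pos : ∀ i → 0 < slack i
    slack-pos i = <-≤-trans (s≤s z≤n) (slack-≥ i)

    ν : ℕ
    ν = maxFin t (λ i → ceilDiv (size i) (slack i))

    ν-isNu : Fin n → IsNu W ν
    ν-isNu p = avoiding-cover ν {{>-nonZero ν>0}} size≤ν*slack , ν≤length
      where
      ν>0 : 0 < ν
      ν>0 = <-≤-trans (ceilDiv-pos (size (c p)) (slack (c p)) (slack-pos (c p))
                                   (≤-trans (m≤m+n _ _) (≤-reflexive (slack+m≡size (c p)))))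
                      (maxFin-ub t _ (c p))
      size≤ν*slack : ∀ i → size i ≤ ν * slack i
      size≤ν*slack i = ≤-trans (ceilDiv-lower (size i) (slack i) (slack-pos i)) (*-monoˡ-≤ (slack i) (maxFin-ub t _ i))
      ν≤length : ∀ L → All (Win W) L → ⋂ L ≡ ⊥ → ν ≤ length L
      ν≤length L wins ⋂L≡⊥ = maxFin-lub t _ λ i →
        ceilDiv-least (size i) (slack i) (slack-pos i) (size≤length*slack L wins ⋂L≡⊥ i)

    coarse : ℕ
    coarse = maxFin t (λ i → ceilDiv (size i) (suc (toℕ i)))

    ν≤coarse : ν ≤ coarse
    ν≤coarse = maxFin-mono t λ i → ceilDiv-antitone (size i) (s≤s z≤n) (slack-≥ i)

    coarse≤2⊔ : coarse ≤ 2 ⊔ (n + 3 ∸ 2 * t)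
    coarse≤2⊔ = maxFin-lub t _ λ i → ceilDiv-≤-2⊔ (size i) n t (suc (toℕ i)) (s≤s z≤n)
      (subst (λ N → size i + 2 * t ≤ N + 2 * suc (toℕ i) + 1) (sumFirst-classSize-all c)
        (sumFirst-gap (classSize c) (λ a → <-≤-trans (s≤s z≤n) (m<classSize noVeto a))
                                    (λ a a+1<t → <-≤-trans (s≤s (m-pos a a+1<t)) (m<classSize noVeto a))
                      (suc (toℕ i)) (toℕ<n i)))

proposition4 : ∀ (n t : ℕ) (W : Subset n → Bool) (c : Fin n → Fin t) (m : Fin t → ℕ)
    → SimpleGame W → NoVetoer W → Complete W → OrderedClasses W c → UniqueSMW W c m
    → (∀ i → 0 < prefix (λ j → classSize c j ∸ m j) i)
      × IsNu W (maxFin t (λ i → ceilDiv (prefix (classSize c) i) (prefix (λ j → classSize c j ∸ m j) i)))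
      × maxFin t (λ i → ceilDiv (prefix (classSize c) i) (prefix (λ j → classSize c j ∸ m j) i))
          ≤ maxFin t (λ i → ceilDiv (prefix (classSize c) i) (suc (toℕ i)))
      × maxFin t (λ i → ceilDiv (prefix (classSize c) i) (suc (toℕ i))) ≤ 2 ⊔ ((n + 3) ∸ (2 * t))
proposition4 zero    t W c m game _ _ _ _ with trans (sym (SimpleGame.empty-losing game)) (SimpleGame.grand-winning game)
... | ()
proposition4 (suc n) t W c m _ noVeto _ ordered unique =
  slack-pos noVeto , ν-isNu noVeto zero , ν≤coarse noVeto , coarse≤2⊔ noVeto
  where open Game ordered unique
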